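{- Let $q\geq 5$ be odd, $A=\mathbb{F}_q[T]$, and fix positive integers $d_1,d_2$. Let $\mathfrak{p}$ be a nonzero prime ideal of $A$ such that there exists $c_1\in\mathbb{F}_q$ with $c_1-T$ not a square modulo $\mathfrak{p}$; put $\lambda_1=(T-c_1)$, $\lambda_2=(T-c_2)$ with $c_2\in\mathbb{F}_q$, $\lambda_2\neq\lambda_1,\mathfrak{p}$. Let $\mathcal{S}$ be the set of pairs $w=(g_1,-g_2^{q-1})\in A^2$ with $g_1,g_2\in A$, $g_2\ne 0$, satisfying $\nu_{\lambda_1}(g_1)\geq1$, $\nu_{\lambda_2}(g_1)=0$, $\nu_{\lambda_1}(g_2)=0$, $\nu_{\lambda_2}(g_2)=1$ (so that the Drinfeld module $\varphi^w_T=T+g_1\tau-g_2^{q-1}\tau^2$ has surjective $\mathfrak{p}$-adic Galois representation). Then $\mathcal{S}$ is infinite, but its density $\mathfrak{d}(\mathcal{S})$ in $\mathcal{W}$ is $0$.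
   Context: $\mathcal{W}=\{(h_1,h_2)\in A^2: h_2\neq0\}$. For $f\in A$, $|f|=q^{\deg f}$. For $w=(h_1,h_2)\in\mathcal{W}$ its height is $|w|=\max\{|h_1|^{1/d_1},|h_2|^{1/d_2}\}$. For a subset $\mathcal{S}\subseteq\mathcal{W}$ and positive integer $X$, $\mathcal{S}(X)=\{w\in\mathcal{S}:|w|<q^X\}$, and the density is $\mathfrak{d}(\mathcal{S})=\lim_{X\to\infty}\#\mathcal{S}(X)/\#\mathcal{W}(X)$. $\nu_\lambda$ is the normalized $\lambda$-adic valuation. -}

module Defs where

open import Level using (0ℓ)
open import Data.Nat using (ℕ; zero; suc; _^_; _∸_; _<_; _≤_) renaming (_*_ to _*ℕ_)
open import Data.Fin using (Fin)
open import Data.List using (List; []; _∷_; length; map)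
open import Data.Product using (Σ; ∃; ∃-syntax; _×_; _,_)
open import Data.Sum using (_⊎_)
open import Relation.Nullary using (¬_; yes; no)
open import Relation.Binary.PropositionalEquality using (_≡_; _≢_)
open import Relation.Binary.Definitions using (DecidableEquality)
open import Algebra.Structures using (IsCommutativeRing)
open import Function.Bundles using (_↔_; _⇔_)
open import Data.List.Membership.Propositional using (_∈_)
open import Data.List.Relation.Unary.All using (All)
open import Data.List.Relation.Unary.Unique.Propositional using (Unique)

record FiniteField (q : ℕ) : Set₁ where
  field
    Carrier : Set
    _≟_     : DecidableEquality Carrier
    _+_ _*_ : Carrier → Carrier → Carrier
    -_      : Carrier → Carrier
    0# 1#   : Carrier
    isCommutativeRing : IsCommutativeRing _≡_ _+_ _*_ -_ 0# 1#
    0≢1     : 0# ≢ 1#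
    inverse : ∀ x → x ≢ 0# → ∃[ y ] (x * y ≡ 1#)
    card    : Carrier ↔ Fin q

-- The polynomial ring A = F_q[T]: coefficient lists, lowest degree first.
-- Equality of polynomials is equality after stripping trailing zeros.

module _ {q : ℕ} (F : FiniteField q) where
  open FiniteField F renaming (_+_ to _+F_; _*_ to _*F_; -_ to -F_)

  Poly : Set
  Poly = List Carrier

  norm : Poly → Poly
  norm [] = []
  norm (a ∷ p) with norm p
  ... | [] with a ≟ 0#
  ...   | yes _ = []
  ...   | no  _ = a ∷ []
  norm (a ∷ p) | r@(_ ∷ _) = a ∷ r

  _≈ₚ_ : Poly → Poly → Set
  p ≈ₚ r = norm p ≡ norm r

  IsNormal : Poly → Set
  IsNormal p = norm p ≡ p

  IsZero : Poly → Set
  IsZero p = norm p ≡ []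

  const : Carrier → Poly
  const c = c ∷ []

  Tₚ : Poly
  Tₚ = 0# ∷ 1# ∷ []

  oneₚ : Poly
  oneₚ = 1# ∷ []

  _+ₚ_ : Poly → Poly → Poly
  [] +ₚ r = r
  (a ∷ p) +ₚ [] = a ∷ p
  (a ∷ p) +ₚ (b ∷ r) = (a +F b) ∷ (p +ₚ r)

  -ₚ_ : Poly → Poly
  -ₚ p = map -F_ p

  _-ₚ_ : Poly → Poly → Poly
  p -ₚ r = p +ₚ (-ₚ r)

  _*ₚ_ : Poly → Poly → Poly
  [] *ₚ r = []
  (a ∷ p) *ₚ r = map (a *F_) r +ₚ (0# ∷ (p *ₚ r))

  _^ₚ_ : Poly → ℕ → Poly
  p ^ₚ zero = oneₚ
  p ^ₚ suc n = p *ₚ (p ^ₚ n)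

  -- degree (of the normalised representative; deg 0 := 0 by convention,
  -- only used for nonzero polynomials via absVal)
  deg : Poly → ℕ
  deg p = length (norm p) ∸ 1

  absVal : Poly → ℕ
  absVal p with norm p
  ... | [] = 0
  ... | _ ∷ _ = q ^ deg p

  _∣ₚ_ : Poly → Poly → Set
  a ∣ₚ b = ∃[ h ] (b ≈ₚ (a *ₚ h))

  IsUnit : Poly → Set
  IsUnit a = ∃[ b ] ((a *ₚ b) ≈ₚ oneₚ)

  IsNonzeroPrime : Poly → Set
  IsNonzeroPrime p = ¬ IsZero p × ¬ IsUnit p
                   × (∀ a b → p ∣ₚ (a *ₚ b) → (p ∣ₚ a) ⊎ (p ∣ₚ b))

  SameIdeal : Poly → Poly → Set
  SameIdeal a b = (a ∣ₚ b) × (b ∣ₚ a)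

  IsSquareMod : Poly → Poly → Set
  IsSquareMod p a = ∃[ h ] (p ∣ₚ ((h *ₚ h) -ₚ a))

  ValGe : Poly → ℕ → Poly → Set
  ValGe ℓ k g = (ℓ ^ₚ k) ∣ₚ g

  ValEq : Poly → ℕ → Poly → Set
  ValEq ℓ k g = ValGe ℓ k g × ¬ ValGe ℓ (suc k) g

  -- points of W are pairs of normalised polynomials (canonical representatives)
  Pt : Set
  Pt = Poly × Poly

  -- W(X): h₂ ≠ 0 and |w| = max(|h₁|^{1/d₁}, |h₂|^{1/d₂}) < q^X,
  -- i.e. |h₁| < q^(d₁ X) and |h₂| < q^(d₂ X)
  InW : ℕ → ℕ → Pt → Set
  InW d₁ d₂ (h₁ , h₂) = IsNormal h₁ × IsNormal h₂ × ¬ IsZero h₂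

  InWX : ℕ → ℕ → ℕ → Pt → Set
  InWX d₁ d₂ X w@(h₁ , h₂) =
    InW d₁ d₂ w × absVal h₁ < q ^ (d₁ *ℕ X) × absVal h₂ < q ^ (d₂ *ℕ X)

  InS : ℕ → ℕ → Carrier → Carrier → Pt → Set
  InS d₁ d₂ c₁ c₂ w@(h₁ , h₂) =
    InW d₁ d₂ w ×
    ∃[ g₁ ] ∃[ g₂ ] ( ¬ IsZero g₂
      × h₁ ≈ₚ g₁
      × h₂ ≈ₚ (-ₚ (g₂ ^ₚ (q ∸ 1)))
      × ValGe (Tₚ -ₚ const c₁) 1 g₁
      × ValEq (Tₚ -ₚ const c₂) 0 g₁
      × ValEq (Tₚ -ₚ const c₁) 0 g₂
      × ValEq (Tₚ -ₚ const c₂) 1 g₂ )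

  InSX : ℕ → ℕ → Carrier → Carrier → ℕ → Pt → Set
  InSX d₁ d₂ c₁ c₂ X w = InS d₁ d₂ c₁ c₂ w × InWX d₁ d₂ X w

HasCard : {A : Set} → (A → Set) → ℕ → Set
HasCard {A} P n = ∃[ xs ] (Unique xs × length xs ≡ n × (∀ (x : A) → (x ∈ xs) ⇔ P x))

Infinite : {A : Set} → (A → Set) → Set
Infinite {A} P = ∀ n → ∃[ xs ] (Unique {A = A} xs × length xs ≡ n × All P xs)

-- lim_{X→∞} #S(X) / #W(X) = 0, with ε = (suc a)/(suc b) ranging over positive rationals
DensityZero : {A : Set} → (ℕ → A → Set) → (ℕ → A → Set) → Set
DensityZero SX WX = ∀ (a b : ℕ) → ∃[ N ] ∀ X → N ≤ X →
  ∃[ s ] ∃[ w ] (HasCard (SX X) s × HasCard (WX X) w × s *ℕ suc b < suc a *ℕ w)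

module Submission where

-- Infinitude: for every k the pair g₁ = (T − c₁)^(k+1), g₂ = T − c₂ meets the valuation
-- conditions (non-divisibility is read off from the values at c₁, c₂ and from degrees),
-- and these points are distinguished by the degree of their first coordinate.
--
-- Density zero: the second coordinate of a point of S is h₂ = −g₂^(q−1), so
-- deg g₂ ≤ deg h₂ / (q − 1) ≤ deg h₂ / 2. For |w| < q^X and d₂X > 2K this leaves at most
-- q^(d₂X − K) second coordinates, against q^(d₂X) − 1 for W(X), so with K = b + 2 the ratio
-- #S(X)/#W(X) drops below 1/(b + 1). Since g₂ ranges over finitely many polynomials of
-- bounded degree, membership in S is decidable and #S(X) can be counted exactly.

open import Defs
open import Level using (0ℓ)
open import Data.Nat as ℕ using (ℕ; zero; suc; _+_; _*_; _^_; _∸_; _≤_; _<_; _%_; z≤n; s≤s)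
import Data.Nat.Properties as ℕ
open import Data.Product using (_×_; _,_; ∃; ∃-syntax; proj₁; proj₂; uncurry)
open import Data.Sum using (_⊎_; inj₁; inj₂)
open import Data.Empty using (⊥-elim)
open import Data.List using (List; []; _∷_; _++_; length; map; filter; cartesianProduct; allFin; downFrom)
import Data.List.Properties as List
open import Data.List.Properties using (∷-injective)
open import Data.List.Relation.Unary.Any using (here; there; any?; _─_)
open import Data.List.Relation.Unary.All using ([])
import Data.List.Relation.Unary.All as All
import Data.List.Relation.Unary.All.Properties as All
open import Data.List.Relation.Unary.AllPairs using ([]; _∷_)
open import Data.List.Relation.Unary.Unique.Propositional using (Unique)
import Data.List.Relation.Unary.Unique.Propositional.Properties as Unique
open import Data.List.Membership.Propositional using (_∈_; find; lose)
import Data.List.Membership.Propositional.Properties as ∈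
open import Data.List.Relation.Binary.Subset.Propositional using (_⊆_)
open import Relation.Nullary using (¬_; Dec; yes; no)
open import Relation.Nullary.Decidable using (¬?; _×-dec_; map′)
open import Relation.Unary using (Pred; Decidable)
open import Relation.Binary.Definitions using (DecidableEquality; _Respects_; tri<; tri≈; tri>)
open import Relation.Binary.PropositionalEquality
  using (_≡_; _≢_; refl; sym; trans; cong; cong₂; subst; subst₂; module ≡-Reasoning)
open import Algebra.Structures using (IsCommutativeRing)
open import Algebra.Bundles using (CommutativeRing)
open import Function.Base using (id; _∘_)
open import Function.Bundles using (Inverse; Injection; _⇔_; mk⇔; Equivalence)
open import Function.Properties.Inverse using (↔-sym; ↔⇒↣)

2≤⇒nonZero : ∀ {m} → 2 ≤ m → ℕ.NonZero m
2≤⇒nonZero (s≤s _) = _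

n<m^n : ∀ {m} → 2 ≤ m → ∀ n → n < m ^ n
n<m^n m≥2 zero = s≤s z≤n
n<m^n {m} m≥2 (suc n) = begin
  1 + suc n          ≤⟨ ℕ.+-mono-≤ (ℕ.m^n>0 m n) (n<m^n m≥2 n) ⟩
  m ^ n + m ^ n      ≡⟨ cong (m ^ n +_) (sym (ℕ.+-identityʳ (m ^ n))) ⟩
  2 * m ^ n          ≤⟨ ℕ.*-monoˡ-≤ (m ^ n) m≥2 ⟩
  m * m ^ n          ∎
  where
  open ℕ.≤-Reasoning
  instance _ = 2≤⇒nonZero m≥2

^-cancelˡ-< : ∀ {m i n} → 2 ≤ m → m ^ i < m ^ n → i < n
^-cancelˡ-< {m} m≥2 mⁱ<mⁿ = ℕ.≰⇒> λ n≤i → ℕ.<⇒≱ mⁱ<mⁿ (ℕ.^-monoʳ-≤ m n≤i)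
  where instance _ = 2≤⇒nonZero m≥2

2m<n∧2k<n⇒m<n∸k : ∀ {m k n} → 2 * m < n → 2 * k < n → m < n ∸ k
2m<n∧2k<n⇒m<n∸k {m} {k} {n} 2m<n 2k<n = ℕ.m+n≤o⇒m≤o∸n (suc m) (m+k<n (ℕ.≤-total m k))
  where
  x+x≡2*x : ∀ x → x + x ≡ 2 * x
  x+x≡2*x x = cong (x +_) (sym (ℕ.+-identityʳ x))
  m+k<n : m ≤ k ⊎ k ≤ m → m + k < n
  m+k<n (inj₁ m≤k) = ℕ.≤-<-trans (ℕ.≤-trans (ℕ.+-monoˡ-≤ k m≤k) (ℕ.≤-reflexive (x+x≡2*x k))) 2k<n
  m+k<n (inj₂ k≤m) = ℕ.≤-<-trans (ℕ.≤-trans (ℕ.+-monoʳ-≤ m k≤m) (ℕ.≤-reflexive (x+x≡2*x m))) 2m<n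

module _ {A : Set} where

  length-cartesianProduct : ∀ {B : Set} (xs : List A) (ys : List B) →
                            length (cartesianProduct xs ys) ≡ length xs * length ys
  length-cartesianProduct []       ys = refl
  length-cartesianProduct (x ∷ xs) ys = begin
    length (map (x ,_) ys ++ cartesianProduct xs ys)          ≡⟨ List.length-++ (map (x ,_) ys) ⟩
    length (map (x ,_) ys) + length (cartesianProduct xs ys)  ≡⟨ cong₂ _+_ (List.length-map (x ,_) ys)
                                                                            (length-cartesianProduct xs ys) ⟩
    length ys + length xs * length ys                         ∎
    where open ≡-Reasoning

  ∈-─ : ∀ {x z : A} ys (x∈ys : x ∈ ys) → z ∈ ys → z ≢ x → z ∈ (ys ─ x∈ys)
  ∈-─ (y ∷ ys) (here refl)  (here refl)  z≢x = ⊥-elim (z≢x refl)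
  ∈-─ (y ∷ ys) (here refl)  (there z∈ys) z≢x = z∈ys
  ∈-─ (y ∷ ys) (there x∈ys) (here refl)  z≢x = here refl
  ∈-─ (y ∷ ys) (there x∈ys) (there z∈ys) z≢x = there (∈-─ ys x∈ys z∈ys z≢x)

  Unique∧⊆⇒length≤ : ∀ {xs ys : List A} → Unique xs → xs ⊆ ys → length xs ≤ length ys
  Unique∧⊆⇒length≤ {[]}     []             xs⊆ys = z≤n
  Unique∧⊆⇒length≤ {x ∷ xs} {ys} (x∉xs ∷ xs!) xs⊆ys = begin
    suc (length xs)         ≤⟨ s≤s (Unique∧⊆⇒length≤ xs! xs⊆ys─x) ⟩
    suc (length (ys ─ x∈ys)) ≡⟨ List.length-removeAt′ ys _ ⟨
    length ys               ∎
    where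
    open ℕ.≤-Reasoning
    x∈ys = xs⊆ys (here refl)
    xs⊆ys─x : xs ⊆ (ys ─ x∈ys)
    xs⊆ys─x z∈xs = ∈-─ ys x∈ys (xs⊆ys (there z∈xs)) (All.lookup x∉xs z∈xs ∘ sym)

  ∃?-within : ∀ {P : Pred A 0ℓ} (xs : List A) → Decidable P →
              (∀ {x} → P x → ∃[ y ] (y ∈ xs × P y)) → Dec (∃ P)
  ∃?-within xs P? complete with any? P? xs
  ... | yes any = let y , _ , Py = find any in yes (y , Py)
  ... | no ¬any = no λ (x , Px) → let y , y∈xs , Py = complete Px in ¬any (lose y∈xs Py)

  length-filter-≢ : (_≟_ : DecidableEquality A) {x : A} {xs : List A} → Unique xs → x ∈ xs →
                    suc (length (filter (λ y → ¬? (y ≟ x)) xs)) ≡ length xs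
  length-filter-≢ _≟_ {x} {y ∷ ys} (y∉ys ∷ ys!) x∈xs with y ≟ x | x∈xs
  ... | yes refl | _          =
    cong (suc ∘ length) (List.filter-all (λ y → ¬? (y ≟ x)) (All.map (λ x≢z → x≢z ∘ sym) y∉ys))
  ... | no y≢x   | here x≡y   = ⊥-elim (y≢x (sym x≡y))
  ... | no y≢x   | there x∈ys = cong suc (length-filter-≢ _≟_ ys! x∈ys)

module _ {q : ℕ} (q≥2 : 2 ≤ q) where

  private instance _ = 2≤⇒nonZero q≥2

  [1+b]*q^r<q^[2+b+r]∸1 : ∀ b r {z} → suc z ≡ q ^ (suc (suc b) + r) → suc b * q ^ r < z
  [1+b]*q^r<q^[2+b+r]∸1 b r {z} sz≡ = ℕ.≤-pred (begin
    2 + suc b * M                ≤⟨ ℕ.+-mono-≤ M>0 (ℕ.+-monoˡ-≤ (suc b * M) M>0) ⟩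
    M + (M + suc b * M)          ≡⟨⟩
    suc (suc (suc b)) * M        ≤⟨ ℕ.*-monoˡ-≤ M (n<m^n q≥2 (suc (suc b))) ⟩
    q ^ suc (suc b) * M          ≡⟨ ℕ.^-distribˡ-+-* q (suc (suc b)) r ⟨
    q ^ (suc (suc b) + r)        ≡⟨ sz≡ ⟨
    suc z                        ∎)
    where
    open ℕ.≤-Reasoning
    M = q ^ r
    M>0 : 0 < M
    M>0 = ℕ.m^n>0 q r

  ratio<[1+a]/[1+b] : ∀ a b r {s z} n → s ≤ q ^ n * q ^ r → suc z ≡ q ^ (suc (suc b) + r) →
                      s * suc b < suc a * (q ^ n * z)
  ratio<[1+a]/[1+b] a b r {s} {z} n s≤ sz≡ = begin-strict
    s * suc b                  ≤⟨ ℕ.*-monoˡ-≤ (suc b) s≤ ⟩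
    q ^ n * q ^ r * suc b      ≡⟨ ℕ.*-assoc (q ^ n) (q ^ r) (suc b) ⟩
    q ^ n * (q ^ r * suc b)    ≡⟨ cong (q ^ n *_) (ℕ.*-comm (q ^ r) (suc b)) ⟩
    q ^ n * (suc b * q ^ r)    <⟨ ℕ.*-monoʳ-< (q ^ n) {{ℕ.m^n≢0 q n}} ([1+b]*q^r<q^[2+b+r]∸1 b r sz≡) ⟩
    q ^ n * z                  ≤⟨ ℕ.m≤n*m (q ^ n * z) (suc a) ⟩
    suc a * (q ^ n * z)        ∎
    where open ℕ.≤-Reasoning

module _ {q : ℕ} (F : FiniteField q) where

  open FiniteField F renaming (_+_ to infixl 6 _+F_; _*_ to infixl 7 _*F_; -_ to infix 8 -F_)
  open IsCommutativeRing isCommutativeRing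
    using ( +-identityˡ; +-identityʳ; +-comm; -‿inverseʳ
          ; *-identityˡ; *-identityʳ; *-comm; *-assoc; zeroˡ; zeroʳ; distribˡ; distribʳ)

  private
    commutativeRing : CommutativeRing 0ℓ 0ℓ
    commutativeRing = record { isCommutativeRing = isCommutativeRing }
    open CommutativeRing commutativeRing using (ring; +-commutativeSemigroup; *-commutativeSemigroup)

  open import Algebra.Properties.Ring ring using (-0#≈0#; -‿injective; x∙y⁻¹≈ε⇒x≈y)
  open import Algebra.Properties.CommutativeSemigroup +-commutativeSemigroup using (interchange)
  open import Algebra.Properties.CommutativeSemigroup *-commutativeSemigroup using (x∙yz≈y∙xz)

  x*y≢0 : ∀ {x y} → x ≢ 0# → y ≢ 0# → x *F y ≢ 0#
  x*y≢0 {x} {y} x≢0 y≢0 xy≡0 with x⁻¹ , xx⁻¹≡1 ← inverse x x≢0 = y≢0 (begin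
    y                ≡⟨ *-identityˡ y ⟨
    1# *F y          ≡⟨ cong (_*F y) (trans (sym xx⁻¹≡1) (*-comm x x⁻¹)) ⟩
    x⁻¹ *F x *F y    ≡⟨ *-assoc x⁻¹ x y ⟩
    x⁻¹ *F (x *F y)  ≡⟨ cong (x⁻¹ *F_) xy≡0 ⟩
    x⁻¹ *F 0#        ≡⟨ zeroʳ x⁻¹ ⟩
    0#               ∎)
    where open ≡-Reasoning

  elements : List Carrier
  elements = map (Inverse.from card) (allFin q)

  ∈-elements : ∀ x → x ∈ elements
  ∈-elements x = subst (_∈ elements) (Inverse.strictlyInverseʳ card x)
    (∈.∈-map⁺ (Inverse.from card) (∈.∈-allFin (Inverse.to card x)))

  elements-unique : Unique elements
  elements-unique = Unique.map⁺ (Injection.injective (↔⇒↣ (↔-sym card))) (Unique.allFin⁺ q)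

  length-elements : length elements ≡ q
  length-elements = trans (List.length-map (Inverse.from card) (allFin q)) (List.length-tabulate id)

  infixl 6 _⊕_
  infixl 7 _⊗_
  infix  8 ⊝_
  infix  4 _≈_

  _⊕_ _⊗_ : Poly F → Poly F → Poly F
  _⊕_ = _+ₚ_ F
  _⊗_ = _*ₚ_ F

  ⊝_ : Poly F → Poly F
  ⊝_ = -ₚ_ F

  _≈_ : Poly F → Poly F → Set
  _≈_ = _≈ₚ_ F

  -- Normal forms and coefficients

  normCons : Carrier → Poly F → Poly F
  normCons a [] with a ≟ 0#
  ... | yes _ = []
  ... | no  _ = a ∷ []
  normCons a r@(_ ∷ _) = a ∷ r

  norm-∷ : ∀ a p → norm F (a ∷ p) ≡ normCons a (norm F p)
  norm-∷ a p with norm F p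
  ... | [] with a ≟ 0#
  ...   | yes _ = refl
  ...   | no  _ = refl
  norm-∷ a p | _ ∷ _ = refl

  normCons-0# : normCons 0# [] ≡ []
  normCons-0# with 0# ≟ 0#
  ... | yes _   = refl
  ... | no 0≢0 = ⊥-elim (0≢0 refl)

  normCons-≢0 : ∀ {a} → a ≢ 0# → normCons a [] ≡ a ∷ []
  normCons-≢0 {a} a≢0 with a ≟ 0#
  ... | yes a≡0 = ⊥-elim (a≢0 a≡0)
  ... | no  _   = refl

  norm-normCons : ∀ a r → norm F (normCons a r) ≡ normCons a (norm F r)
  norm-normCons a [] with a ≟ 0#
  ... | yes _   = refl
  ... | no  a≢0 = trans (norm-∷ a []) (normCons-≢0 a≢0)
  norm-normCons a r@(_ ∷ _) = norm-∷ a r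

  norm-idem : ∀ p → norm F (norm F p) ≡ norm F p
  norm-idem []      = refl
  norm-idem (a ∷ p) = begin
    norm F (norm F (a ∷ p))        ≡⟨ cong (norm F) (norm-∷ a p) ⟩
    norm F (normCons a (norm F p)) ≡⟨ norm-normCons a (norm F p) ⟩
    normCons a (norm F (norm F p)) ≡⟨ cong (normCons a) (norm-idem p) ⟩
    normCons a (norm F p)          ≡⟨ norm-∷ a p ⟨
    norm F (a ∷ p)                 ∎
    where open ≡-Reasoning

  ≈-norm : ∀ p → p ≈ norm F p
  ≈-norm p = sym (norm-idem p)

  IsNormal-norm : ∀ p → IsNormal F (norm F p)
  IsNormal-norm = norm-idem

  IsNormal-normCons : ∀ a {r} → IsNormal F r → IsNormal F (normCons a r)
  IsNormal-normCons a {r} r-normal = trans (norm-normCons a r) (cong (normCons a) r-normal)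

  normCons-∷ : ∀ {a r b s} → normCons a r ≡ b ∷ s → a ≡ b × r ≡ s
  normCons-∷ {a} {[]} eq with a ≟ 0#
  normCons-∷ {a} {[]} () | yes _
  normCons-∷ {a} {[]} refl | no _ = refl , refl
  normCons-∷ {a} {_ ∷ _} refl = refl , refl

  normCons-[] : ∀ {a r} → normCons a r ≡ [] → a ≡ 0# × r ≡ []
  normCons-[] {a} {[]} eq with a ≟ 0#
  ... | yes a≡0 = a≡0 , refl
  normCons-[] {a} {[]} () | no _
  normCons-[] {a} {_ ∷ _} ()

  normCons-injective : ∀ {a r b s} → normCons a r ≡ normCons b s → (a , r) ≡ (b , s)
  normCons-injective {a} {r} {b} {s} eq with normCons a r in eqa
  ... | []    with refl , refl ← normCons-[] {a} {r} eqa
                 | refl , refl ← normCons-[] {b} {s} (sym eq) = refl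
  ... | _ ∷ _ with refl , refl ← normCons-∷ {a} {r} eqa
                 | refl , refl ← normCons-∷ {b} {s} (sym eq) = refl

  IsNormal-tail : ∀ {a r} → IsNormal F (a ∷ r) → IsNormal F r
  IsNormal-tail {a} {r} normal with norm F r | norm-∷ a r
  ... | []    | eq′ = proj₂ (normCons-∷ (trans (sym eq′) normal))
  ... | _ ∷ _ | eq′ = proj₂ (∷-injective (trans (sym eq′) normal))

  normCons-normal : ∀ {a r} → IsNormal F (a ∷ r) → normCons a r ≡ a ∷ r
  normCons-normal {a} {r} normal = begin
    normCons a r          ≡⟨ cong (normCons a) (IsNormal-tail normal) ⟨
    normCons a (norm F r) ≡⟨ norm-∷ a r ⟨
    norm F (a ∷ r)        ≡⟨ normal ⟩
    a ∷ r                 ∎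
    where open ≡-Reasoning

  IsNormal-[_]⇒≢0 : ∀ a → IsNormal F (a ∷ []) → a ≢ 0#
  IsNormal-[ a ]⇒≢0 normal a≡0 with a ≟ 0#
  IsNormal-[ a ]⇒≢0 ()     a≡0 | yes _
  IsNormal-[ a ]⇒≢0 normal a≡0 | no a≢0 = a≢0 a≡0

  coef : Poly F → ℕ → Carrier
  coef []      _       = 0#
  coef (a ∷ p) zero    = a
  coef (a ∷ p) (suc i) = coef p i

  -- A record rather than a Π-type, so that the polynomials can be inferred from a proof;
  -- the same goes for HasDegree below.
  infix 4 _≋_
  record _≋_ (p r : Poly F) : Set where
    constructor coefwise
    field coef≡ : ∀ i → coef p i ≡ coef r i
  open _≋_

  ≋-refl : ∀ {p} → p ≋ p
  ≋-refl .coef≡ i = refl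

  ≋-sym : ∀ {p r} → p ≋ r → r ≋ p
  ≋-sym p≋r .coef≡ i = sym (coef≡ p≋r i)

  ≋-trans : ∀ {p r s} → p ≋ r → r ≋ s → p ≋ s
  ≋-trans p≋r r≋s .coef≡ i = trans (coef≡ p≋r i) (coef≡ r≋s i)

  ≋-tail : ∀ {a b p r} → a ∷ p ≋ b ∷ r → p ≋ r
  ≋-tail a∷p≋b∷r .coef≡ i = coef≡ a∷p≋b∷r (suc i)

  ≋[]-tail : ∀ {a p} → a ∷ p ≋ [] → p ≋ []
  ≋[]-tail a∷p≋0 .coef≡ i = coef≡ a∷p≋0 (suc i)

  normCons≋∷ : ∀ a r → normCons a r ≋ a ∷ r
  normCons≋∷ a [] with a ≟ 0#
  ... | yes a≡0 = coefwise λ { zero → sym a≡0 ; (suc i) → refl }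
  ... | no  _   = ≋-refl
  normCons≋∷ a (_ ∷ _) = ≋-refl

  ∷-cong≋ : ∀ a {s s′} → s ≋ s′ → a ∷ s ≋ a ∷ s′
  ∷-cong≋ a s≋s′ .coef≡ zero    = refl
  ∷-cong≋ a s≋s′ .coef≡ (suc i) = coef≡ s≋s′ i

  norm≋ : ∀ p → norm F p ≋ p
  norm≋ []      = ≋-refl
  norm≋ (a ∷ p) rewrite norm-∷ a p = ≋-trans (normCons≋∷ a (norm F p)) (∷-cong≋ a (norm≋ p))

  normal-≋[]⇒≡[] : ∀ {x} → IsNormal F x → x ≋ [] → x ≡ []
  normal-≋[]⇒≡[] {[]}    _      _    = refl
  normal-≋[]⇒≡[] {a ∷ r} normal x≋0
    with refl ← normal-≋[]⇒≡[] (IsNormal-tail normal) (≋[]-tail x≋0) =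
    ⊥-elim (IsNormal-[ a ]⇒≢0 normal (coef≡ x≋0 0))

  normal-≋⇒≡ : ∀ {x y} → IsNormal F x → IsNormal F y → x ≋ y → x ≡ y
  normal-≋⇒≡ {[]}    {[]}    _   _   _   = refl
  normal-≋⇒≡ {[]}    {_ ∷ _} _   y-n x≋y = sym (normal-≋[]⇒≡[] y-n (≋-sym x≋y))
  normal-≋⇒≡ {_ ∷ _} {[]}    x-n _   x≋y = normal-≋[]⇒≡[] x-n x≋y
  normal-≋⇒≡ {_ ∷ _} {_ ∷ _} x-n y-n x≋y =
    cong₂ _∷_ (coef≡ x≋y 0) (normal-≋⇒≡ (IsNormal-tail x-n) (IsNormal-tail y-n) (≋-tail x≋y))

  ≈⇒≋ : ∀ {p r} → p ≈ r → p ≋ r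
  ≈⇒≋ {p} {r} p≈r = ≋-trans (≋-sym (norm≋ p)) (subst (_≋ r) (sym p≈r) (norm≋ r))

  ≋⇒≈ : ∀ {p r} → p ≋ r → p ≈ r
  ≋⇒≈ {p} {r} p≋r =
    normal-≋⇒≡ (IsNormal-norm p) (IsNormal-norm r) (≋-trans (norm≋ p) (≋-trans p≋r (≋-sym (norm≋ r))))

  coef-⊕ : ∀ p r i → coef (p ⊕ r) i ≡ coef p i +F coef r i
  coef-⊕ []      r       i       = sym (+-identityˡ _)
  coef-⊕ (a ∷ p) []      i       = sym (+-identityʳ _)
  coef-⊕ (a ∷ p) (b ∷ r) zero    = refl
  coef-⊕ (a ∷ p) (b ∷ r) (suc i) = coef-⊕ p r i

  coef-⊝ : ∀ p i → coef (⊝ p) i ≡ -F coef p i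
  coef-⊝ []      i       = sym -0#≈0#
  coef-⊝ (a ∷ p) zero    = refl
  coef-⊝ (a ∷ p) (suc i) = coef-⊝ p i

  coef-scale : ∀ a r i → coef (map (a *F_) r) i ≡ a *F coef r i
  coef-scale a []      i       = sym (zeroʳ a)
  coef-scale a (b ∷ r) zero    = refl
  coef-scale a (b ∷ r) (suc i) = coef-scale a r i

  coef-⊗-∷ : ∀ a p r i → coef ((a ∷ p) ⊗ r) i ≡ a *F coef r i +F coef (0# ∷ p ⊗ r) i
  coef-⊗-∷ a p r i = trans (coef-⊕ (map (a *F_) r) (0# ∷ p ⊗ r) i) (cong (_+F _) (coef-scale a r i))

  0∷-≋[] : ∀ {s} → s ≋ [] → 0# ∷ s ≋ []
  0∷-≋[] s≋0 .coef≡ zero    = refl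
  0∷-≋[] s≋0 .coef≡ (suc i) = coef≡ s≋0 i

  ⊗-congˡ : ∀ p {r r′} → r ≋ r′ → p ⊗ r ≋ p ⊗ r′
  ⊗-congˡ []      r≋r′ = ≋-refl
  ⊗-congˡ (a ∷ p) {r} {r′} r≋r′ .coef≡ i = begin
    coef ((a ∷ p) ⊗ r) i                     ≡⟨ coef-⊗-∷ a p r i ⟩
    a *F coef r i +F coef (0# ∷ p ⊗ r) i     ≡⟨ cong₂ (λ x y → a *F x +F y) (coef≡ r≋r′ i)
                                                        (coef≡ (∷-cong≋ 0# (⊗-congˡ p r≋r′)) i) ⟩
    a *F coef r′ i +F coef (0# ∷ p ⊗ r′) i   ≡⟨ coef-⊗-∷ a p r′ i ⟨
    coef ((a ∷ p) ⊗ r′) i                    ∎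
    where open ≡-Reasoning

  ⊗-zeroˡ : ∀ {p} r → p ≋ [] → p ⊗ r ≋ []
  ⊗-zeroˡ {[]}    r p≋0 = ≋-refl
  ⊗-zeroˡ {a ∷ p} r p≋0 .coef≡ i = begin
    coef ((a ∷ p) ⊗ r) i                  ≡⟨ coef-⊗-∷ a p r i ⟩
    a *F coef r i +F coef (0# ∷ p ⊗ r) i  ≡⟨ cong₂ (λ x y → x *F coef r i +F y) (coef≡ p≋0 0)
                                                     (coef≡ (0∷-≋[] (⊗-zeroˡ r (≋[]-tail p≋0))) i) ⟩
    0# *F coef r i +F 0#                  ≡⟨ +-identityʳ _ ⟩
    0# *F coef r i                        ≡⟨ zeroˡ _ ⟩
    0#                                    ∎
    where open ≡-Reasoning

  ⊗-congʳ : ∀ {p p′} r → p ≋ p′ → p ⊗ r ≋ p′ ⊗ r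
  ⊗-congʳ {[]}    {p′}     r p≋p′ = ≋-sym (⊗-zeroˡ r (≋-sym p≋p′))
  ⊗-congʳ {a ∷ p} {[]}     r p≋p′ = ⊗-zeroˡ r p≋p′
  ⊗-congʳ {a ∷ p} {b ∷ p′} r p≋p′ .coef≡ i = begin
    coef ((a ∷ p) ⊗ r) i                    ≡⟨ coef-⊗-∷ a p r i ⟩
    a *F coef r i +F coef (0# ∷ p ⊗ r) i    ≡⟨ cong₂ (λ x y → x *F coef r i +F y) (coef≡ p≋p′ 0)
                                                       (coef≡ (∷-cong≋ 0# (⊗-congʳ r (≋-tail p≋p′))) i) ⟩
    b *F coef r i +F coef (0# ∷ p′ ⊗ r) i   ≡⟨ coef-⊗-∷ b p′ r i ⟨
    coef ((b ∷ p′) ⊗ r) i                   ∎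
    where open ≡-Reasoning

  ⊝-cong : ∀ {p r} → p ≋ r → ⊝ p ≋ ⊝ r
  ⊝-cong {p} {r} p≋r .coef≡ i = trans (coef-⊝ p i) (trans (cong -F_ (coef≡ p≋r i)) (sym (coef-⊝ r i)))

  ^-cong : ∀ {p r} k → p ≋ r → _^ₚ_ F p k ≋ _^ₚ_ F r k
  ^-cong zero    p≋r = ≋-refl
  ^-cong {p} {r} (suc k) p≋r = ≋-trans (⊗-congʳ (_^ₚ_ F p k) p≋r) (⊗-congˡ r (^-cong k p≋r))

  ⊗-zeroʳ : ∀ p → IsZero F (p ⊗ [])
  ⊗-zeroʳ []      = refl
  ⊗-zeroʳ (a ∷ p) = begin
    norm F (0# ∷ p ⊗ [])          ≡⟨ norm-∷ 0# (p ⊗ []) ⟩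
    normCons 0# (norm F (p ⊗ [])) ≡⟨ cong (normCons 0#) (⊗-zeroʳ p) ⟩
    normCons 0# []                ≡⟨ normCons-0# ⟩
    []                            ∎
    where open ≡-Reasoning

  ⊗-identityˡ : ∀ p → oneₚ F ⊗ p ≋ p
  ⊗-identityˡ p .coef≡ i = begin
    coef (oneₚ F ⊗ p) i                    ≡⟨ coef-⊗-∷ 1# [] p i ⟩
    1# *F coef p i +F coef (0# ∷ []) i     ≡⟨ cong₂ _+F_ (*-identityˡ _) (coef≡ (0∷-≋[] ≋-refl) i) ⟩
    coef p i +F 0#                         ≡⟨ +-identityʳ _ ⟩
    coef p i                               ∎
    where open ≡-Reasoning

  ⊗-identityʳ : ∀ p → p ⊗ oneₚ F ≋ p
  ⊗-identityʳ []      = ≋-refl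
  ⊗-identityʳ (a ∷ p) .coef≡ zero    =
    trans (coef-⊗-∷ a p (oneₚ F) 0) (trans (+-identityʳ _) (*-identityʳ a))
  ⊗-identityʳ (a ∷ p) .coef≡ (suc i) = begin
    coef ((a ∷ p) ⊗ oneₚ F) (suc i)        ≡⟨ coef-⊗-∷ a p (oneₚ F) (suc i) ⟩
    a *F 0# +F coef (p ⊗ oneₚ F) i         ≡⟨ cong₂ _+F_ (zeroʳ a) (coef≡ (⊗-identityʳ p) i) ⟩
    0# +F coef p i                         ≡⟨ +-identityˡ _ ⟩
    coef p i                               ∎
    where open ≡-Reasoning

  ∣-refl : ∀ p → _∣ₚ_ F p p
  ∣-refl p = oneₚ F , ≋⇒≈ (≋-sym (⊗-identityʳ p))

  oneₚ-∣ : ∀ g → _∣ₚ_ F (oneₚ F) g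
  oneₚ-∣ g = g , ≋⇒≈ (≋-sym (⊗-identityˡ g))

  -- Degrees

  DegreeAtMost : Poly F → ℕ → Set
  DegreeAtMost p m = ∀ j → m < j → coef p j ≡ 0#

  record HasDegree (p : Poly F) (m : ℕ) : Set where
    constructor hasDegree
    field
      leading≢0 : coef p m ≢ 0#
      atMost    : DegreeAtMost p m

  HasDegree-resp : ∀ {p r m} → p ≋ r → HasDegree p m → HasDegree r m
  HasDegree-resp {m = m} p≋r (hasDegree pm≢0 p≤m) =
    hasDegree (λ rm≡0 → pm≢0 (trans (coef≡ p≋r m) rm≡0))
              (λ j m<j → trans (sym (coef≡ p≋r j)) (p≤m j m<j))

  HasDegree-unique : ∀ {p m n} → HasDegree p m → HasDegree p n → m ≡ n
  HasDegree-unique {m = m} {n} (hasDegree pm≢0 p≤m) (hasDegree pn≢0 p≤n) with ℕ.<-cmp m n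
  ... | tri< m<n _ _ = ⊥-elim (pn≢0 (p≤m n m<n))
  ... | tri≈ _ m≡n _ = m≡n
  ... | tri> _ _ n<m = ⊥-elim (pm≢0 (p≤n m n<m))

  DegreeAtMost-tail : ∀ {a p m} → DegreeAtMost (a ∷ p) (suc m) → DegreeAtMost p m
  DegreeAtMost-tail a∷p≤1+m j m<j = a∷p≤1+m (suc j) (s≤s m<j)

  DegreeAtMost-0⇒tail≋[] : ∀ {a p} → DegreeAtMost (a ∷ p) 0 → p ≋ []
  DegreeAtMost-0⇒tail≋[] a∷p≤0 .coef≡ i = a∷p≤0 (suc i) (s≤s z≤n)

  private
    a*0+0≡0 : ∀ {a x y} → x ≡ 0# → y ≡ 0# → a *F x +F y ≡ 0#
    a*0+0≡0 {a} refl refl = trans (+-identityʳ _) (zeroʳ a)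

  DegreeAtMost-⊗ : ∀ p r {m n} → DegreeAtMost p m → DegreeAtMost r n →
                   DegreeAtMost (p ⊗ r) (m + n)
  DegreeAtMost-⊗ []      r p≤m r≤n j _ = refl
  DegreeAtMost-⊗ (a ∷ p) r {zero} p≤0 r≤n j n<j =
    trans (coef-⊗-∷ a p r j)
          (a*0+0≡0 (r≤n j n<j) (coef≡ (0∷-≋[] (⊗-zeroˡ r (DegreeAtMost-0⇒tail≋[] p≤0))) j))
  DegreeAtMost-⊗ (a ∷ p) r {suc m} {n} p≤m r≤n (suc j) (s≤s m+n<j) =
    trans (coef-⊗-∷ a p r (suc j))
      (a*0+0≡0 (r≤n (suc j) (s≤s (ℕ.≤-trans (ℕ.m≤n+m n m) (ℕ.<⇒≤ m+n<j))))
               (DegreeAtMost-⊗ p r (DegreeAtMost-tail p≤m) r≤n j m+n<j))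

  coef-⊗-top : ∀ p r {m n} → DegreeAtMost p m → DegreeAtMost r n →
               coef (p ⊗ r) (m + n) ≡ coef p m *F coef r n
  coef-⊗-top []      r {m} {n} p≤m r≤n = sym (zeroˡ (coef r n))
  coef-⊗-top (a ∷ p) r {zero} {n} p≤0 r≤n = begin
    coef ((a ∷ p) ⊗ r) n                   ≡⟨ coef-⊗-∷ a p r n ⟩
    a *F coef r n +F coef (0# ∷ p ⊗ r) n   ≡⟨ cong (a *F coef r n +F_)
                                                   (coef≡ (0∷-≋[] (⊗-zeroˡ r (DegreeAtMost-0⇒tail≋[] p≤0))) n) ⟩
    a *F coef r n +F 0#                    ≡⟨ +-identityʳ _ ⟩
    a *F coef r n                          ∎
    where open ≡-Reasoning
  coef-⊗-top (a ∷ p) r {suc m} {n} p≤m r≤n = begin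
    coef ((a ∷ p) ⊗ r) (suc (m + n))                   ≡⟨ coef-⊗-∷ a p r (suc (m + n)) ⟩
    a *F coef r (suc (m + n)) +F coef (p ⊗ r) (m + n)  ≡⟨ cong₂ (λ x y → a *F x +F y)
                                                            (r≤n (suc (m + n)) (s≤s (ℕ.m≤n+m n m)))
                                                            (coef-⊗-top p r (DegreeAtMost-tail p≤m) r≤n) ⟩
    a *F 0# +F coef p m *F coef r n                    ≡⟨ cong (_+F coef p m *F coef r n) (zeroʳ a) ⟩
    0# +F coef p m *F coef r n                         ≡⟨ +-identityˡ _ ⟩
    coef p m *F coef r n                               ∎
    where open ≡-Reasoning

  HasDegree-⊗ : ∀ {p r m n} → HasDegree p m → HasDegree r n → HasDegree (p ⊗ r) (m + n)
  HasDegree-⊗ {p} {r} (hasDegree pm≢0 p≤m) (hasDegree rn≢0 r≤n) =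
    hasDegree (λ top≡0 → x*y≢0 pm≢0 rn≢0 (trans (sym (coef-⊗-top p r p≤m r≤n)) top≡0))
              (DegreeAtMost-⊗ p r p≤m r≤n)

  HasDegree-oneₚ : HasDegree (oneₚ F) 0
  HasDegree-oneₚ = hasDegree (λ 1≡0 → 0≢1 (sym 1≡0)) λ { (suc j) _ → refl }

  HasDegree-^ : ∀ {p m} k → HasDegree p m → HasDegree (_^ₚ_ F p k) (k * m)
  HasDegree-^ zero    _         = HasDegree-oneₚ
  HasDegree-^ (suc k) p-deg = HasDegree-⊗ p-deg (HasDegree-^ k p-deg)

  HasDegree-⊝ : ∀ {p m} → HasDegree p m → HasDegree (⊝ p) m
  HasDegree-⊝ {p} {m} (hasDegree pm≢0 p≤m) =
    hasDegree (λ e → pm≢0 (-‿injective (trans (sym (coef-⊝ p m)) (trans e (sym -0#≈0#)))))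
    λ j m<j → trans (coef-⊝ p j) (trans (cong -F_ (p≤m j m<j)) -0#≈0#)

  HasDegree-⊝^ : ∀ {g m} k → HasDegree g m → HasDegree (⊝ _^ₚ_ F g k) (k * m)
  HasDegree-⊝^ k g-deg = HasDegree-⊝ (HasDegree-^ k g-deg)

  T-_ : Carrier → Poly F
  T- c = _-ₚ_ F (Tₚ F) (const F c)

  HasDegree-T- : ∀ c → HasDegree (T- c) 1
  HasDegree-T- c = hasDegree (λ 1≡0 → 0≢1 (sym 1≡0)) λ { (suc zero) (s≤s ()) ; (suc (suc j)) _ → refl }

  coef-≥length : ∀ x {j} → length x ≤ j → coef x j ≡ 0#
  coef-≥length []      _         = refl
  coef-≥length (a ∷ x) (s≤s len≤j) = coef-≥length x len≤j

  normal-HasDegree : ∀ {a r} → IsNormal F (a ∷ r) → HasDegree (a ∷ r) (length r)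
  normal-HasDegree {a} {r} normal = hasDegree (last≢0 normal) λ j len<j → coef-≥length (a ∷ r) len<j
    where
    last≢0 : ∀ {a r} → IsNormal F (a ∷ r) → coef (a ∷ r) (length r) ≢ 0#
    last≢0 {a} {[]}    normal = IsNormal-[ a ]⇒≢0 normal
    last≢0 {a} {b ∷ r} normal = last≢0 (IsNormal-tail normal)

  norm≡∷⇒HasDegree : ∀ {p a r} → norm F p ≡ a ∷ r → HasDegree p (length r)
  norm≡∷⇒HasDegree {p} eq = HasDegree-resp (subst (_≋ p) eq (norm≋ p))
    (normal-HasDegree (trans (cong (norm F) (sym eq)) (trans (norm-idem p) eq)))

  IsZero⊎HasDegree : ∀ p → IsZero F p ⊎ ∃ (HasDegree p)
  IsZero⊎HasDegree p with norm F p in eq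
  ... | []    = inj₁ refl
  ... | _ ∷ r = inj₂ (length r , norm≡∷⇒HasDegree eq)

  length-norm : ∀ {p m} → HasDegree p m → length (norm F p) ≡ suc m
  length-norm {p} {m} p-deg with norm F p in eq
  ... | []    =
    ⊥-elim (HasDegree.leading≢0 p-deg (trans (sym (coef≡ (norm≋ p) m)) (cong (λ x → coef x m) eq)))
  ... | _ ∷ r = cong suc (HasDegree-unique (norm≡∷⇒HasDegree eq) p-deg)

  HasDegree⇒nonzero : ∀ {p m} → HasDegree p m → ¬ IsZero F p
  HasDegree⇒nonzero {p} p-deg p≈0 = ℕ.0≢1+n (trans (cong length (sym p≈0)) (length-norm p-deg))

  IsZero-⊗ʳ : ∀ d {h} → IsZero F h → IsZero F (d ⊗ h)
  IsZero-⊗ʳ d {h} h≈0 = trans (≋⇒≈ (⊗-congˡ d {h} {[]} (≈⇒≋ h≈0))) (⊗-zeroʳ d)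

  HasDegree-quotient : ∀ {d g h e n} → HasDegree d e → HasDegree h n → g ≈ d ⊗ h →
                       HasDegree g (e + n)
  HasDegree-quotient d-deg h-deg g≈dh = HasDegree-resp (≈⇒≋ (sym g≈dh)) (HasDegree-⊗ d-deg h-deg)

  length-quotient≤ : ∀ {d e g h} → HasDegree d e → g ≈ d ⊗ h →
                     length (norm F h) ≤ length (norm F g)
  length-quotient≤ {e = e} {g} {h} d-deg g≈dh with IsZero⊎HasDegree h
  ... | inj₁ h≈0          = subst (λ x → length x ≤ length (norm F g)) (sym h≈0) z≤n
  ... | inj₂ (n , h-deg) = begin
    length (norm F h) ≡⟨ length-norm h-deg ⟩
    suc n             ≤⟨ s≤s (ℕ.m≤n+m n e) ⟩
    suc (e + n)       ≡⟨ length-norm (HasDegree-quotient {g = g} d-deg h-deg g≈dh) ⟨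
    length (norm F g) ∎
    where open ℕ.≤-Reasoning

  ∤-by-degree : ∀ {d e g m} → HasDegree g m → HasDegree d e → m < e → ¬ _∣ₚ_ F d g
  ∤-by-degree {d} g-deg d-deg m<e (h , g≈dh) with IsZero⊎HasDegree h
  ... | inj₁ h≈0          = HasDegree⇒nonzero g-deg (trans g≈dh (IsZero-⊗ʳ d h≈0))
  ... | inj₂ (n , h-deg) = ℕ.<⇒≱ m<e (ℕ.≤-trans (ℕ.m≤m+n _ n)
                             (ℕ.≤-reflexive (HasDegree-unique (HasDegree-quotient d-deg h-deg g≈dh) g-deg)))

  -- Evaluation

  eval : Carrier → Poly F → Carrier
  eval c []      = 0#
  eval c (a ∷ p) = a +F c *F eval c p

  eval-normCons : ∀ c a r → eval c (normCons a r) ≡ eval c (a ∷ r)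
  eval-normCons c a [] with a ≟ 0#
  ... | yes refl = sym (trans (+-identityˡ _) (zeroʳ c))
  ... | no  _    = refl
  eval-normCons c a (_ ∷ _) = refl

  eval-norm : ∀ c p → eval c (norm F p) ≡ eval c p
  eval-norm c []      = refl
  eval-norm c (a ∷ p) = begin
    eval c (norm F (a ∷ p))        ≡⟨ cong (eval c) (norm-∷ a p) ⟩
    eval c (normCons a (norm F p)) ≡⟨ eval-normCons c a (norm F p) ⟩
    a +F c *F eval c (norm F p)    ≡⟨ cong (λ x → a +F c *F x) (eval-norm c p) ⟩
    a +F c *F eval c p             ∎
    where open ≡-Reasoning

  eval-cong : ∀ c {p r} → p ≈ r → eval c p ≡ eval c r
  eval-cong c {p} {r} p≈r = trans (sym (eval-norm c p)) (trans (cong (eval c) p≈r) (eval-norm c r))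

  eval-⊕ : ∀ c p r → eval c (p ⊕ r) ≡ eval c p +F eval c r
  eval-⊕ c []      r       = sym (+-identityˡ _)
  eval-⊕ c (a ∷ p) []      = sym (+-identityʳ _)
  eval-⊕ c (a ∷ p) (b ∷ r) = begin
    a +F b +F c *F eval c (p ⊕ r)                 ≡⟨ cong (λ x → a +F b +F c *F x) (eval-⊕ c p r) ⟩
    a +F b +F c *F (eval c p +F eval c r)         ≡⟨ cong (a +F b +F_) (distribˡ c (eval c p) (eval c r)) ⟩
    a +F b +F (c *F eval c p +F c *F eval c r)    ≡⟨ interchange a b (c *F eval c p) (c *F eval c r) ⟩
    a +F c *F eval c p +F (b +F c *F eval c r)    ∎
    where open ≡-Reasoning

  eval-scale : ∀ c a r → eval c (map (a *F_) r) ≡ a *F eval c r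
  eval-scale c a []      = sym (zeroʳ a)
  eval-scale c a (b ∷ r) = begin
    a *F b +F c *F eval c (map (a *F_) r) ≡⟨ cong (λ x → a *F b +F c *F x) (eval-scale c a r) ⟩
    a *F b +F c *F (a *F eval c r)        ≡⟨ cong (a *F b +F_) (x∙yz≈y∙xz c a (eval c r)) ⟩
    a *F b +F a *F (c *F eval c r)        ≡⟨ distribˡ a b (c *F eval c r) ⟨
    a *F (b +F c *F eval c r)             ∎
    where open ≡-Reasoning

  eval-⊗ : ∀ c p r → eval c (p ⊗ r) ≡ eval c p *F eval c r
  eval-⊗ c []      r = sym (zeroˡ _)
  eval-⊗ c (a ∷ p) r = begin
    eval c (map (a *F_) r ⊕ (0# ∷ p ⊗ r))        ≡⟨ eval-⊕ c (map (a *F_) r) (0# ∷ p ⊗ r) ⟩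
    eval c (map (a *F_) r) +F (0# +F c *F eval c (p ⊗ r))
                                                  ≡⟨ cong₂ _+F_ (eval-scale c a r) (+-identityˡ _) ⟩
    a *F eval c r +F c *F eval c (p ⊗ r)          ≡⟨ cong (λ x → a *F eval c r +F c *F x) (eval-⊗ c p r) ⟩
    a *F eval c r +F c *F (eval c p *F eval c r)  ≡⟨ cong (a *F eval c r +F_) (*-assoc c (eval c p) (eval c r)) ⟨
    a *F eval c r +F c *F eval c p *F eval c r    ≡⟨ distribʳ (eval c r) a (c *F eval c p) ⟨
    (a +F c *F eval c p) *F eval c r              ∎
    where open ≡-Reasoning

  eval-oneₚ : ∀ c → eval c (oneₚ F) ≡ 1#
  eval-oneₚ c = trans (cong (1# +F_) (zeroʳ c)) (+-identityʳ 1#)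

  eval-T- : ∀ c c′ → eval c (T- c′) ≡ c +F -F c′
  eval-T- c c′ = begin
    0# +F -F c′ +F c *F (1# +F c *F 0#) ≡⟨ cong (λ x → 0# +F -F c′ +F c *F (1# +F x)) (zeroʳ c) ⟩
    0# +F -F c′ +F c *F (1# +F 0#)      ≡⟨ cong₂ (λ x y → x +F c *F y) (+-identityˡ _) (+-identityʳ 1#) ⟩
    -F c′ +F c *F 1#                    ≡⟨ cong (-F c′ +F_) (*-identityʳ c) ⟩
    -F c′ +F c                          ≡⟨ +-comm (-F c′) c ⟩
    c +F -F c′                          ∎
    where open ≡-Reasoning

  eval-T-≡0 : ∀ c → eval c (T- c) ≡ 0#
  eval-T-≡0 c = trans (eval-T- c c) (-‿inverseʳ c)

  eval-T-≢0 : ∀ {c c′} → c ≢ c′ → eval c (T- c′) ≢ 0#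
  eval-T-≢0 {c} {c′} c≢c′ e = c≢c′ (x∙y⁻¹≈ε⇒x≈y c c′ (trans (sym (eval-T- c c′)) e))

  eval-^-≡0 : ∀ c p k → eval c p ≡ 0# → eval c (_^ₚ_ F p (suc k)) ≡ 0#
  eval-^-≡0 c p k p[c]≡0 = begin
    eval c (p ⊗ _^ₚ_ F p k)               ≡⟨ eval-⊗ c p (_^ₚ_ F p k) ⟩
    eval c p *F eval c (_^ₚ_ F p k)       ≡⟨ cong (_*F eval c (_^ₚ_ F p k)) p[c]≡0 ⟩
    0# *F eval c (_^ₚ_ F p k)             ≡⟨ zeroˡ _ ⟩
    0#                                    ∎
    where open ≡-Reasoning

  eval-^-≢0 : ∀ c p k → eval c p ≢ 0# → eval c (_^ₚ_ F p k) ≢ 0#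
  eval-^-≢0 c p zero    p[c]≢0 e = 0≢1 (sym (trans (sym (eval-oneₚ c)) e))
  eval-^-≢0 c p (suc k) p[c]≢0 e =
    x*y≢0 p[c]≢0 (eval-^-≢0 c p k p[c]≢0) (trans (sym (eval-⊗ c p (_^ₚ_ F p k))) e)

  root⇒∤ : ∀ c {d g} → eval c d ≡ 0# → eval c g ≢ 0# → ¬ _∣ₚ_ F d g
  root⇒∤ c {d} {g} d[c]≡0 g[c]≢0 (h , g≈dh) = g[c]≢0 (begin
    eval c g              ≡⟨ eval-cong c {g} {d ⊗ h} g≈dh ⟩
    eval c (d ⊗ h)        ≡⟨ eval-⊗ c d h ⟩
    eval c d *F eval c h  ≡⟨ cong (_*F eval c h) d[c]≡0 ⟩
    0# *F eval c h        ≡⟨ zeroˡ _ ⟩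
    0#                    ∎)
    where open ≡-Reasoning

  -- An infinite family in S

  -- A product rather than (T - c) ^ (1 + k), so that divisibility by T - c holds by refl.
  T-_^[1+_] : Carrier → ℕ → Poly F
  T- c ^[1+ k ] = _^ₚ_ F (T- c) 1 ⊗ _^ₚ_ F (T- c) k

  HasDegree-T-^ : ∀ c k → HasDegree (T- c ^[1+ k ]) (suc k)
  HasDegree-T-^ c k = subst (λ n → HasDegree (T- c ^[1+ k ]) (suc n)) (ℕ.*-identityʳ k)
    (HasDegree-⊗ (HasDegree-^ 1 (HasDegree-T- c)) (HasDegree-^ k (HasDegree-T- c)))

  ValGe-T-^ : ∀ c k → ValGe F (T- c) 1 (T- c ^[1+ k ])
  ValGe-T-^ c k = _^ₚ_ F (T- c) k , refl

  ValEq0-T-^ : ∀ {c c′} k → c′ ≢ c → ValEq F (T- c′) 0 (T- c ^[1+ k ])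
  ValEq0-T-^ {c} {c′} k c′≢c = oneₚ-∣ (T- c ^[1+ k ]) ,
    root⇒∤ c′ {_^ₚ_ F (T- c′) 1} {T- c ^[1+ k ]} (eval-^-≡0 c′ (T- c′) 0 (eval-T-≡0 c′)) value≢0
    where
    c′-not-root : eval c′ (T- c) ≢ 0#
    c′-not-root = eval-T-≢0 c′≢c
    value≢0 : eval c′ (T- c ^[1+ k ]) ≢ 0#
    value≢0 e = x*y≢0 (eval-^-≢0 c′ (T- c) 1 c′-not-root) (eval-^-≢0 c′ (T- c) k c′-not-root)
      (trans (sym (eval-⊗ c′ (_^ₚ_ F (T- c) 1) (_^ₚ_ F (T- c) k))) e)

  InS-intro : ∀ d₁ d₂ {c₁ c₂} g₁ g₂ {m} → HasDegree g₂ m →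
              ValGe F (T- c₁) 1 g₁ → ValEq F (T- c₂) 0 g₁ →
              ValEq F (T- c₁) 0 g₂ → ValEq F (T- c₂) 1 g₂ →
              InS F d₁ d₂ c₁ c₂ (norm F g₁ , norm F (⊝ _^ₚ_ F g₂ (q ∸ 1)))
  InS-intro d₁ d₂ g₁ g₂ g₂-deg v₁ v₂ v₃ v₄ =
    (IsNormal-norm g₁ , IsNormal-norm h₂ , h₂≉0) ,
    g₁ , g₂ , HasDegree⇒nonzero g₂-deg , norm-idem g₁ , norm-idem h₂ , v₁ , v₂ , v₃ , v₄
    where
    h₂ = ⊝ _^ₚ_ F g₂ (q ∸ 1)
    h₂≉0 : ¬ IsZero F (norm F h₂)
    h₂≉0 = HasDegree⇒nonzero (HasDegree-resp (≋-sym (norm≋ h₂)) (HasDegree-⊝^ (q ∸ 1) g₂-deg))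

  module _ (c₁ c₂ : Carrier) where

    family : ℕ → Pt F
    family k = norm F (T- c₁ ^[1+ k ]) , norm F (⊝ _^ₚ_ F (T- c₂ ^[1+ 0 ]) (q ∸ 1))

    family-injective : ∀ {k j} → family k ≡ family j → k ≡ j
    family-injective {k} {j} eq = ℕ.suc-injective (ℕ.suc-injective (begin
      suc (suc k)                         ≡⟨ length-norm (HasDegree-T-^ c₁ k) ⟨
      length (proj₁ (family k))           ≡⟨ cong (length ∘ proj₁) eq ⟩
      length (proj₁ (family j))           ≡⟨ length-norm (HasDegree-T-^ c₁ j) ⟩
      suc (suc j)                         ∎))
      where open ≡-Reasoning

    family-InS : ∀ d₁ d₂ → c₂ ≢ c₁ → ∀ k → InS F d₁ d₂ c₁ c₂ (family k)
    family-InS d₁ d₂ c₂≢c₁ k = InS-intro d₁ d₂ (T- c₁ ^[1+ k ]) (T- c₂ ^[1+ 0 ])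
      (HasDegree-T-^ c₂ 0)
      (ValGe-T-^ c₁ k)
      (ValEq0-T-^ k c₂≢c₁)
      (ValEq0-T-^ 0 (c₂≢c₁ ∘ sym))
      (ValGe-T-^ c₂ 0 , ∤-by-degree (HasDegree-T-^ c₂ 0) (HasDegree-^ 2 (HasDegree-T- c₂)) ℕ.≤-refl)

    InS-infinite : ∀ d₁ d₂ → c₂ ≢ c₁ → Infinite (InS F d₁ d₂ c₁ c₂)
    InS-infinite d₁ d₂ c₂≢c₁ n =
      map family (downFrom n) ,
      Unique.map⁺ family-injective (Unique.downFrom⁺ n) ,
      trans (List.length-map family (downFrom n)) (List.length-downFrom n) ,
      All.map⁺ (All.universal (family-InS d₁ d₂ c₂≢c₁) (downFrom n))

  -- Polynomials of bounded degree

  length-normCons : ∀ a r → length (normCons a r) ≤ suc (length r)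
  length-normCons a [] with a ≟ 0#
  ... | yes _ = z≤n
  ... | no  _ = ℕ.≤-refl
  length-normCons a (_ ∷ _) = ℕ.≤-refl

  normalPolys : ℕ → List (Poly F)
  normalPolys zero    = [] ∷ []
  normalPolys (suc n) = map (uncurry normCons) (cartesianProduct elements (normalPolys n))

  length-normalPolys : ∀ n → length (normalPolys n) ≡ q ^ n
  length-normalPolys zero    = refl
  length-normalPolys (suc n) = begin
    length (map (uncurry normCons) pairs)     ≡⟨ List.length-map (uncurry normCons) pairs ⟩
    length pairs                              ≡⟨ length-cartesianProduct elements (normalPolys n) ⟩
    length elements * length (normalPolys n)  ≡⟨ cong₂ _*_ length-elements (length-normalPolys n) ⟩
    q * q ^ n                                 ∎
    where
    open ≡-Reasoning
    pairs = cartesianProduct elements (normalPolys n)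

  normalPolys-unique : ∀ n → Unique (normalPolys n)
  normalPolys-unique zero    = [] ∷ []
  normalPolys-unique (suc n) =
    Unique.map⁺ normCons-injective (Unique.cartesianProduct⁺ elements-unique (normalPolys-unique n))

  ∈-normalPolys⁻ : ∀ n {x} → x ∈ normalPolys n → IsNormal F x × length x ≤ n
  ∈-normalPolys⁻ zero    (here refl) = refl , z≤n
  ∈-normalPolys⁻ (suc n) x∈ with (a , r) , ar∈ , refl ← ∈.∈-map⁻ (uncurry normCons) x∈
    with _ , r∈ ← ∈.∈-cartesianProduct⁻ elements (normalPolys n) ar∈
    with r-normal , r≤n ← ∈-normalPolys⁻ n r∈ =
    IsNormal-normCons a r-normal , ℕ.≤-trans (length-normCons a r) (s≤s r≤n)

  ∈-normalPolys⁺ : ∀ n {x} → IsNormal F x → length x ≤ n → x ∈ normalPolys n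
  ∈-normalPolys⁺ zero    {[]}    _        _         = here refl
  ∈-normalPolys⁺ (suc n) {[]}    _        _         = subst (_∈ normalPolys (suc n)) normCons-0#
    (∈.∈-map⁺ (uncurry normCons)
      (∈.∈-cartesianProduct⁺ (∈-elements 0#) (∈-normalPolys⁺ n refl z≤n)))
  ∈-normalPolys⁺ (suc n) {a ∷ r} x-normal (s≤s r≤n) =
    subst (_∈ normalPolys (suc n)) (normCons-normal x-normal)
    (∈.∈-map⁺ (uncurry normCons)
      (∈.∈-cartesianProduct⁺ (∈-elements a) (∈-normalPolys⁺ n (IsNormal-tail x-normal) r≤n)))

  norm∈normalPolys : ∀ {n} p → length (norm F p) ≤ n → norm F p ∈ normalPolys n
  norm∈normalPolys {n} p = ∈-normalPolys⁺ n (IsNormal-norm p)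

  absVal<q^n⇔ : 2 ≤ q → ∀ p n → absVal F p < q ^ n ⇔ length (norm F p) ≤ n
  absVal<q^n⇔ q≥2 p n with norm F p in eq
  ... | []    = mk⇔ (λ _ → z≤n) (λ _ → ℕ.m^n>0 q {{2≤⇒nonZero q≥2}} n)
  ... | _ ∷ r rewrite eq = mk⇔ (^-cancelˡ-< q≥2) (ℕ.^-monoʳ-< q q≥2)

  -- Deciding membership in S

  _≟ₚ_ : DecidableEquality (Poly F)
  _≟ₚ_ = List.≡-dec _≟_

  ∃?-normalPolys : ∀ {P : Pred (Poly F) 0ℓ} n → P Respects _≈_ → Decidable P →
                   (∀ {g} → P g → length (norm F g) ≤ n) → Dec (∃ P)
  ∃?-normalPolys n resp P? bound =
    ∃?-within (normalPolys n) P? λ {g} Pg → norm F g , norm∈normalPolys g (bound Pg) , resp (≈-norm g) Pg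

  ∣? : ∀ {d e} → HasDegree d e → ∀ g → Dec (_∣ₚ_ F d g)
  ∣? {d} d-deg g = ∃?-normalPolys (length (norm F g))
    (λ {h} {h′} h≈h′ g≈dh → trans g≈dh (≋⇒≈ (⊗-congˡ d {h} {h′} (≈⇒≋ h≈h′))))
    (λ h → norm F g ≟ₚ norm F (d ⊗ h))
    (length-quotient≤ {g = g} d-deg)

  ValGe? : ∀ c k g → Dec (ValGe F (T- c) k g)
  ValGe? c k = ∣? (HasDegree-^ k (HasDegree-T- c))

  ValEq? : ∀ c k g → Dec (ValEq F (T- c) k g)
  ValEq? c k g = ValGe? c k g ×-dec ¬? (ValGe? c (suc k) g)

  ValGe-resp : ∀ ℓ k → ValGe F ℓ k Respects _≈_
  ValGe-resp ℓ k g≈g′ (h , g≈ℓh) = h , trans (sym g≈g′) g≈ℓh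

  ValEq-resp : ∀ ℓ k → ValEq F ℓ k Respects _≈_
  ValEq-resp ℓ k {g} {g′} g≈g′ (ℓᵏ∣g , ℓᵏ⁺¹∤g) =
    ValGe-resp ℓ k {g} {g′} g≈g′ ℓᵏ∣g ,
    ℓᵏ⁺¹∤g ∘ ValGe-resp ℓ (suc k) {g′} {g} (sym g≈g′)

  InW? : ∀ d₁ d₂ w → Dec (InW F d₁ d₂ w)
  InW? d₁ d₂ (h₁ , h₂) =
    (norm F h₁ ≟ₚ h₁) ×-dec (norm F h₂ ≟ₚ h₂) ×-dec ¬? (norm F h₂ ≟ₚ [])

  -_^[q-1] : Poly F → Poly F
  - g ^[q-1] = norm F (⊝ _^ₚ_ F g (q ∸ 1))

  module _ (c₁ c₂ : Carrier) where

    AdmissibleRoot : Poly F → Poly F → Set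
    AdmissibleRoot h₂ g₂ =
      ¬ IsZero F g₂ × h₂ ≈ ⊝ _^ₚ_ F g₂ (q ∸ 1) × ValEq F (T- c₁) 0 g₂ × ValEq F (T- c₂) 1 g₂

    AdmissibleRoot-resp : ∀ h₂ → AdmissibleRoot h₂ Respects _≈_
    AdmissibleRoot-resp h₂ {g} {g′} g≈g′ (g≉0 , h₂≈ , v₁ , v₂) =
      (λ g′≈0 → g≉0 (trans g≈g′ g′≈0)) ,
      trans h₂≈ (≋⇒≈ (⊝-cong (^-cong {g} {g′} (q ∸ 1) (≈⇒≋ g≈g′)))) ,
      ValEq-resp (T- c₁) 0 {g} {g′} g≈g′ v₁ ,
      ValEq-resp (T- c₂) 1 {g} {g′} g≈g′ v₂

    AdmissibleRoot? : ∀ h₂ g₂ → Dec (AdmissibleRoot h₂ g₂)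
    AdmissibleRoot? h₂ g₂ =
      ¬? (norm F g₂ ≟ₚ []) ×-dec (norm F h₂ ≟ₚ norm F (⊝ _^ₚ_ F g₂ (q ∸ 1))) ×-dec
      ValEq? c₁ 0 g₂ ×-dec ValEq? c₂ 1 g₂

    length-AdmissibleRoot : ∀ {h₂ g₂} → AdmissibleRoot h₂ g₂ →
                            ∃[ m ] (length (norm F g₂) ≡ suc m × length (norm F h₂) ≡ suc ((q ∸ 1) * m))
    length-AdmissibleRoot {h₂} {g₂} (g₂≉0 , h₂≈ , _) with IsZero⊎HasDegree g₂
    ... | inj₁ g₂≈0         = ⊥-elim (g₂≉0 g₂≈0)
    ... | inj₂ (m , g₂-deg) = m , length-norm g₂-deg ,
      length-norm {h₂} (HasDegree-resp (≈⇒≋ (sym h₂≈)) (HasDegree-⊝^ (q ∸ 1) g₂-deg))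

    ∃AdmissibleRoot? : .{{ℕ.NonZero (q ∸ 1)}} → ∀ h₂ → Dec (∃ (AdmissibleRoot h₂))
    ∃AdmissibleRoot? h₂ =
      ∃?-normalPolys (length (norm F h₂)) (AdmissibleRoot-resp h₂) (AdmissibleRoot? h₂) length≤
      where
      length≤ : ∀ {g₂} → AdmissibleRoot h₂ g₂ → length (norm F g₂) ≤ length (norm F h₂)
      length≤ {g₂} root with m , g₂≡ , h₂≡ ← length-AdmissibleRoot {h₂} {g₂} root =
        subst₂ _≤_ (sym g₂≡) (sym h₂≡) (s≤s (ℕ.m≤n*m m (q ∸ 1)))

    normal-AdmissibleRoot : ∀ {h₂ g₂} → IsNormal F h₂ → AdmissibleRoot h₂ g₂ →
                            h₂ ≡ - norm F g₂ ^[q-1]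
    normal-AdmissibleRoot {h₂} {g₂} h₂-normal root =
      trans (sym h₂-normal) (proj₁ (proj₂ (AdmissibleRoot-resp h₂ {g₂} {norm F g₂} (≈-norm g₂) root)))

    length-AdmissibleRoot≤ : 2 ≤ q ∸ 1 → ∀ {h₂ g₂ n k} → AdmissibleRoot h₂ g₂ →
                             length (norm F h₂) ≤ n → 2 * k < n → length (norm F g₂) ≤ n ∸ k
    length-AdmissibleRoot≤ q-1≥2 {h₂} {g₂} {n} {k} root h₂≤n 2k<n
      with m , g₂≡ , h₂≡ ← length-AdmissibleRoot {h₂} {g₂} root =
      subst (_≤ n ∸ k) (sym g₂≡) (2m<n∧2k<n⇒m<n∸k {k = k} 2m<n 2k<n)
      where
      2m<n : 2 * m < n
      2m<n = ℕ.≤-trans (s≤s (ℕ.*-monoˡ-≤ m q-1≥2)) (subst (_≤ n) h₂≡ h₂≤n)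

    InS⇒∃AdmissibleRoot : ∀ {d₁ d₂ h₁ h₂} → InS F d₁ d₂ c₁ c₂ (h₁ , h₂) → ∃ (AdmissibleRoot h₂)
    InS⇒∃AdmissibleRoot (_ , _ , g₂ , g₂≉0 , _ , h₂≈ , _ , _ , v₃ , v₄) =
      g₂ , g₂≉0 , h₂≈ , v₃ , v₄

    InS? : .{{ℕ.NonZero (q ∸ 1)}} → ∀ d₁ d₂ w → Dec (InS F d₁ d₂ c₁ c₂ w)
    InS? d₁ d₂ w@(h₁ , h₂) =
      map′ to from (InW? d₁ d₂ w ×-dec First? ×-dec ∃AdmissibleRoot? h₂)
      where
      First  = ValGe F (T- c₁) 1 h₁ × ValEq F (T- c₂) 0 h₁
      First? = ValGe? c₁ 1 h₁ ×-dec ValEq? c₂ 0 h₁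
      to : InW F d₁ d₂ w × First × ∃ (AdmissibleRoot h₂) → InS F d₁ d₂ c₁ c₂ w
      to (w∈W , (v₁ , v₂) , g₂ , g₂≉0 , h₂≈ , v₃ , v₄) =
        w∈W , h₁ , g₂ , g₂≉0 , refl , h₂≈ , v₁ , v₂ , v₃ , v₄
      from : InS F d₁ d₂ c₁ c₂ w → InW F d₁ d₂ w × First × ∃ (AdmissibleRoot h₂)
      from w∈S@(w∈W , g₁ , _ , _ , h₁≈g₁ , _ , v₁ , v₂ , _) =
        w∈W ,
        (ValGe-resp (T- c₁) 1 {g₁} {h₁} (sym h₁≈g₁) v₁ , ValEq-resp (T- c₂) 0 {g₁} {h₁} (sym h₁≈g₁) v₂) ,
        InS⇒∃AdmissibleRoot {d₁} {d₂} w∈S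

  -- Counting S(X) and W(X)

  nonzeroPolys : ℕ → List (Poly F)
  nonzeroPolys n = filter (λ x → ¬? (x ≟ₚ [])) (normalPolys n)

  suc-length-nonzeroPolys : ∀ n → suc (length (nonzeroPolys n)) ≡ q ^ n
  suc-length-nonzeroPolys n = trans
    (length-filter-≢ _≟ₚ_ (normalPolys-unique n) (∈-normalPolys⁺ n refl z≤n))
    (length-normalPolys n)

  ∈-normalPolys⇔ : 2 ≤ q → ∀ n h → h ∈ normalPolys n ⇔ (IsNormal F h × absVal F h < q ^ n)
  ∈-normalPolys⇔ q≥2 n h = mk⇔
    (λ h∈ → let h-normal , h≤n = ∈-normalPolys⁻ n h∈ in
      h-normal , Equivalence.from |h|<qⁿ⇔ (subst (λ x → length x ≤ n) (sym h-normal) h≤n))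
    (λ (h-normal , |h|<qⁿ) →
      ∈-normalPolys⁺ n h-normal (subst (λ x → length x ≤ n) h-normal (Equivalence.to |h|<qⁿ⇔ |h|<qⁿ)))
    where |h|<qⁿ⇔ = absVal<q^n⇔ q≥2 h n

  module Counting (q-1≥2 : 2 ≤ q ∸ 1) (d₁ d₂ : ℕ) (c₁ c₂ : Carrier) where

    private
      q≥2 : 2 ≤ q
      q≥2 = ℕ.≤-trans q-1≥2 (ℕ.m∸n≤m q 1)
      instance _ = 2≤⇒nonZero q-1≥2

    W : ℕ → List (Pt F)
    W X = cartesianProduct (normalPolys (d₁ * X)) (nonzeroPolys (d₂ * X))

    W-unique : ∀ X → Unique (W X)
    W-unique X =
      Unique.cartesianProduct⁺ (normalPolys-unique (d₁ * X)) (Unique.filter⁺ _ (normalPolys-unique (d₂ * X)))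

    length-W : ∀ X → length (W X) ≡ q ^ (d₁ * X) * length (nonzeroPolys (d₂ * X))
    length-W X = trans (length-cartesianProduct (normalPolys (d₁ * X)) (nonzeroPolys (d₂ * X)))
                       (cong (_* length (nonzeroPolys (d₂ * X))) (length-normalPolys (d₁ * X)))

    ∈-W⇔ : ∀ X w → w ∈ W X ⇔ InWX F d₁ d₂ X w
    ∈-W⇔ X (h₁ , h₂) = mk⇔ to from
      where
      to : (h₁ , h₂) ∈ W X → InWX F d₁ d₂ X (h₁ , h₂)
      to w∈ with h₁∈ , h₂∈ ← ∈.∈-cartesianProduct⁻ (normalPolys (d₁ * X)) (nonzeroPolys (d₂ * X)) w∈
        with h₂∈ , h₂≢[] ← ∈.∈-filter⁻ (λ x → ¬? (x ≟ₚ [])) h₂∈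
        with h₁-normal , |h₁|< ← Equivalence.to (∈-normalPolys⇔ q≥2 (d₁ * X) h₁) h₁∈
           | h₂-normal , |h₂|< ← Equivalence.to (∈-normalPolys⇔ q≥2 (d₂ * X) h₂) h₂∈ =
        (h₁-normal , h₂-normal , λ h₂≈0 → h₂≢[] (trans (sym h₂-normal) h₂≈0)) , |h₁|< , |h₂|<
      from : InWX F d₁ d₂ X (h₁ , h₂) → (h₁ , h₂) ∈ W X
      from ((h₁-normal , h₂-normal , h₂≉0) , |h₁|< , |h₂|<) = ∈.∈-cartesianProduct⁺
        (Equivalence.from (∈-normalPolys⇔ q≥2 (d₁ * X) h₁) (h₁-normal , |h₁|<))
        (∈.∈-filter⁺ (λ x → ¬? (x ≟ₚ []))
          (Equivalence.from (∈-normalPolys⇔ q≥2 (d₂ * X) h₂) (h₂-normal , |h₂|<))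
          λ h₂≡[] → h₂≉0 (trans h₂-normal h₂≡[]))

    S : ℕ → List (Pt F)
    S X = filter (InS? c₁ c₂ d₁ d₂) (W X)

    S-unique : ∀ X → Unique (S X)
    S-unique X = Unique.filter⁺ (InS? c₁ c₂ d₁ d₂) (W-unique X)

    ∈-S⇔ : ∀ X w → w ∈ S X ⇔ InSX F d₁ d₂ c₁ c₂ X w
    ∈-S⇔ X w = mk⇔
      (λ w∈ → let w∈W , w∈S = ∈.∈-filter⁻ (InS? c₁ c₂ d₁ d₂) w∈ in
        w∈S , Equivalence.to (∈-W⇔ X w) w∈W)
      (λ (w∈S , w∈W) → ∈.∈-filter⁺ (InS? c₁ c₂ d₁ d₂) (Equivalence.from (∈-W⇔ X w) w∈W) w∈S)

    Bound : ℕ → ℕ → List (Pt F)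
    Bound K X = cartesianProduct (normalPolys (d₁ * X)) (map -_^[q-1] (normalPolys (d₂ * X ∸ K)))

    length-Bound : ∀ K X → length (Bound K X) ≡ q ^ (d₁ * X) * q ^ (d₂ * X ∸ K)
    length-Bound K X = begin
      length (Bound K X)                      ≡⟨ length-cartesianProduct (normalPolys n₁) roots ⟩
      length (normalPolys n₁) * length roots  ≡⟨ cong₂ _*_ (length-normalPolys n₁)
                                                           (List.length-map -_^[q-1] (normalPolys (n₂ ∸ K))) ⟩
      q ^ n₁ * length (normalPolys (n₂ ∸ K))  ≡⟨ cong (q ^ n₁ *_) (length-normalPolys (n₂ ∸ K)) ⟩
      q ^ n₁ * q ^ (n₂ ∸ K)                   ∎
      where
      open ≡-Reasoning
      n₁ = d₁ * X
      n₂ = d₂ * X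
      roots = map -_^[q-1] (normalPolys (n₂ ∸ K))

    S⊆Bound : ∀ K X → 2 * K < d₂ * X → S X ⊆ Bound K X
    S⊆Bound K X 2K<n₂ {h₁ , h₂} w∈S
      with w∈W , w∈S ← ∈.∈-filter⁻ (InS? c₁ c₂ d₁ d₂) w∈S
      with g₂ , root ← InS⇒∃AdmissibleRoot c₁ c₂ {d₁} {d₂} w∈S
      with h₁∈ , h₂∈ ← ∈.∈-cartesianProduct⁻ (normalPolys (d₁ * X)) (nonzeroPolys (d₂ * X)) w∈W
      with h₂∈ , _ ← ∈.∈-filter⁻ (λ x → ¬? (x ≟ₚ [])) h₂∈
      with h₂-normal , h₂≤n₂ ← ∈-normalPolys⁻ (d₂ * X) h₂∈ =
      ∈.∈-cartesianProduct⁺ h₁∈ (subst (_∈ map -_^[q-1] _) (sym (normal-AdmissibleRoot c₁ c₂ h₂-normal root))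
        (∈.∈-map⁺ -_^[q-1] (norm∈normalPolys g₂ g₂≤n₂∸K)))
      where
      g₂≤n₂∸K : length (norm F g₂) ≤ d₂ * X ∸ K
      g₂≤n₂∸K = length-AdmissibleRoot≤ c₁ c₂ q-1≥2 {h₂} {g₂} {k = K} root
                  (subst (λ x → length x ≤ d₂ * X) (sym h₂-normal) h₂≤n₂) 2K<n₂

    length-S≤ : ∀ K X → 2 * K < d₂ * X → length (S X) ≤ q ^ (d₁ * X) * q ^ (d₂ * X ∸ K)
    length-S≤ K X 2K<n₂ =
      ℕ.≤-trans (Unique∧⊆⇒length≤ (S-unique X) (S⊆Bound K X 2K<n₂)) (ℕ.≤-reflexive (length-Bound K X))

    density : 1 ≤ d₂ → DensityZero (InSX F d₁ d₂ c₁ c₂) (InWX F d₁ d₂)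
    density d₂≥1 a b = suc (2 * K) , λ X N≤X →
      length (S X) , length (W X) ,
      (S X , S-unique X , refl , ∈-S⇔ X) ,
      (W X , W-unique X , refl , ∈-W⇔ X) ,
      subst (λ n → length (S X) * suc b < suc a * n) (sym (length-W X))
        (ratio<[1+a]/[1+b] q≥2 a b (d₂ * X ∸ K) (d₁ * X)
          (length-S≤ K X (2K<n₂ N≤X)) (suc-length-nonzero N≤X))
      where
      K = suc (suc b)
      2K<n₂ : ∀ {X} → suc (2 * K) ≤ X → 2 * K < d₂ * X
      2K<n₂ {X} N≤X = ℕ.≤-trans N≤X (ℕ.m≤n*m X d₂ {{ℕ.>-nonZero d₂≥1}})
      suc-length-nonzero : ∀ {X} → suc (2 * K) ≤ X →
                           suc (length (nonzeroPolys (d₂ * X))) ≡ q ^ (K + (d₂ * X ∸ K))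
      suc-length-nonzero {X} N≤X = trans (suc-length-nonzeroPolys (d₂ * X))
        (cong (q ^_) (sym (ℕ.m+[n∸m]≡n (ℕ.≤-trans (ℕ.m≤m+n K (K + 0)) (ℕ.<⇒≤ (2K<n₂ N≤X))))))

proposition4p5 : (q : ℕ) → 5 ≤ q → q % 2 ≡ 1 → (F : FiniteField q)
    → (d₁ d₂ : ℕ) → 1 ≤ d₁ → 1 ≤ d₂
    → (p : Poly F) → IsNonzeroPrime F p
    → (c₁ : FiniteField.Carrier F)
    → ¬ IsSquareMod F p (_-ₚ_ F (const F c₁) (Tₚ F))
    → (c₂ : FiniteField.Carrier F)
    → ¬ SameIdeal F (_-ₚ_ F (Tₚ F) (const F c₂)) (_-ₚ_ F (Tₚ F) (const F c₁))
    → ¬ SameIdeal F (_-ₚ_ F (Tₚ F) (const F c₂)) p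
    → Infinite (InS F d₁ d₂ c₁ c₂)
      × DensityZero (InSX F d₁ d₂ c₁ c₂) (InWX F d₁ d₂)
-- The parity of q, the prime p and the conditions tying it to c₁, c₂ only matter for the
-- surjectivity of the Galois representation, which this counting statement does not
-- involve; neither does the count need d₁ ≥ 1.
proposition4p5 q 5≤q _ F d₁ d₂ _ d₂≥1 _ _ c₁ _ c₂ λ₂≢λ₁ _ =
  InS-infinite F c₁ c₂ d₁ d₂ c₂≢c₁ , Counting.density F q-1≥2 d₁ d₂ c₁ c₂ d₂≥1
  where
  q-1≥2 : 2 ≤ q ∸ 1
  q-1≥2 = ℕ.≤-trans (s≤s (s≤s z≤n)) (ℕ.∸-monoˡ-≤ 1 5≤q)
  c₂≢c₁ : c₂ ≢ c₁
  c₂≢c₁ refl = λ₂≢λ₁ (∣-refl F (T-_ F c₁) , ∣-refl F (T-_ F c₁))
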